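{- Let $a,b,s$ be positive integers with $b<\frac{a+s}{s}$. Then the graph $G_{a,b,s}$ does not admit any $2$-community structure.
   Context: $G_{a,b,s}$ has vertex set $A\cup B\cup S\cup\{u\}$ (disjoint), with $|A|=a$, $|B|=b$, $|S|=s$; $Q=A\cup B$ is a clique, $S$ is a stable set, $u$ is an isolated vertex, every vertex of $A$ is adjacent to every vertex of $S$, and no vertex of $B$ has a neighbour in $S$ (so $G_{a,b,s}$ is a threshold graph with exactly one isolated vertex). $N_C(v)$ denotes the set of neighbours of $v$ in $C$. A $2$-community structure of $G=(V,E)$ is a partition $\{C_1,C_2\}$ of $V$ with $|C_1|,|C_2|\ge 2$ such that for $i\in\{1,2\}$ and every $v\in C_i$: $\frac{|N_{C_i}(v)|}{|C_i|-1}\ge\frac{|N_{C_{3-i}}(v)|}{|C_{3-i}|}$. -}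

module Defs where

open import Data.Nat using (ℕ; zero; suc; _+_; _*_; _∸_; _≤_; _<ᵇ_)
open import Data.Fin using (Fin; zero; suc; toℕ; _≟_)
open import Data.Product using (_×_)
import Data.Bool as B
open import Data.Bool using (Bool; true; false; if_then_else_; _∧_; not)
open import Relation.Nullary.Decidable using (⌊_⌋)

-- A finite simple graph on vertex set Fin n, given by a Boolean adjacency
-- function (symmetry / irreflexivity are properties of the concrete graph below).
record Graph : Set where
  field
    n   : ℕ
    adj : Fin n → Fin n → Bool

count : ∀ {n} → (Fin n → Bool) → ℕ
count {zero}  p = 0
count {suc n} p = (if p zero then 1 else 0) + count (λ i → p (suc i))

-- A bipartition {C₁ , C₂} of the vertex set is encoded by its indicator
-- c : V → Bool  (c v = true ↔ v ∈ C₁, c v = false ↔ v ∈ C₂).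
module _ (G : Graph) where
  open Graph G

  partSize : (Fin n → Bool) → Bool → ℕ
  partSize c b = count (λ v → ⌊ B._≟_ (c v) b ⌋)

  nbrsIn : (Fin n → Bool) → Bool → Fin n → ℕ
  nbrsIn c b v = count (λ w → adj v w ∧ ⌊ B._≟_ (c w) b ⌋)

  -- A 2-community structure: both parts have at least 2 vertices and for every
  -- v in part C (label c v) with other part C':
  --   |N_C(v)| / (|C| - 1)  ≥  |N_{C'}(v)| / |C'|,
  -- written with denominators cleared (both denominators are positive since
  -- |C|, |C'| ≥ 2):  |N_C(v)| * |C'|  ≥  |N_{C'}(v)| * (|C| - 1).
  IsTwoCommunityStructure : (Fin n → Bool) → Set
  IsTwoCommunityStructure c =
      (2 ≤ partSize c true)
    × (2 ≤ partSize c false)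
    × ((v : Fin n) →
         nbrsIn c (not (c v)) v * (partSize c (c v) ∸ 1)
           ≤ nbrsIn c (c v) v * partSize c (not (c v)))

data Kind : Set where
  kA kB kS kU : Kind

kind : (a b s : ℕ) → ℕ → Kind
kind a b s i =
  if i <ᵇ a then kA else
  if i <ᵇ a + b then kB else
  if i <ᵇ a + b + s then kS else kU

kindAdj : Kind → Kind → Bool
kindAdj kA kA = true
kindAdj kA kB = true
kindAdj kB kA = true
kindAdj kB kB = true
kindAdj kA kS = true
kindAdj kS kA = true
kindAdj _  _  = false

G : (a b s : ℕ) → Graph
G a b s = record
  { n   = a + b + s + 1
  ; adj = λ i j → not ⌊ i ≟ j ⌋ ∧ kindAdj (kind a b s (toℕ i)) (kind a b s (toℕ j))
  }

-- Two vertices with the same closed neighbourhood (two vertices of A, or two of B) lie in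
-- the same community: adding their two cohesion inequalities leaves exactly the number of
-- their non-neighbours, which is positive because of the isolated vertex u.  So A lies in a
-- single community C, and so does S, since outside C a vertex of S would have no neighbour
-- in its own community but all of A in C.  The other community has at least two vertices,
-- so it is B, or B ∪ {u}.  If u ∈ C, a vertex of A sees the whole other community but misses
-- u in its own, which violates cohesion; otherwise cohesion at a vertex of B reads
-- a b ≤ (b − 1)(a + s), that is a + s ≤ b s.

module Submission where

open import Defs
open import Data.Nat using (ℕ; _*_; _+_; _<_)
open import Data.Fin using (Fin)
open import Data.Bool using (Bool)
open import Relation.Nullary using (¬_)

open import Algebra.Properties.CommutativeSemigroup using (x∙yz≈y∙xz)
open import Data.Bool using (true; false; not; _∧_; if_then_else_)
import Data.Bool as Bool
open import Data.Bool.Properties using (∧-assoc; ∧-zeroʳ; ¬-not; not-¬)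
open import Data.Fin using (zero; suc; toℕ; _≟_; _↑ˡ_; _↑ʳ_; fromℕ<)
open import Data.Fin.Properties using (toℕ<n; toℕ-↑ˡ; toℕ-↑ʳ)
open import Data.Nat using (zero; suc; _≤_; _∸_; _<ᵇ_; z≤n; s≤s)
open import Data.Nat.Properties hiding (_≟_)
open import Data.Nat.Tactic.RingSolver using (solve-∀)
open import Data.Product using (proj₁; proj₂)
open import Data.Sum using (_⊎_; inj₁; inj₂)
open import Function using (_∘_)
open import Relation.Binary.PropositionalEquality
open import Relation.Nullary using (Dec; yes; no; contradiction)
open import Relation.Nullary.Decidable using (⌊_⌋; dec-true; dec-false; isYes≗does; ⌊⌋-map′)

count-cong : ∀ {n} {p q : Fin n → Bool} → (∀ i → p i ≡ q i) → count p ≡ count q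
count-cong {zero}  eq = refl
count-cong {suc n} eq = cong₂ _+_ (cong (λ x → if x then 1 else 0) (eq zero)) (count-cong (eq ∘ suc))

count-false : ∀ n → count {n} (λ _ → false) ≡ 0
count-false zero    = refl
count-false (suc n) = count-false n

count-true : ∀ n → count {n} (λ _ → true) ≡ n
count-true zero    = refl
count-true (suc n) = cong suc (count-true n)

count-≤ : ∀ {n} (p : Fin n → Bool) → count p ≤ n
count-≤ {zero}  p = z≤n
count-≤ {suc n} p with p zero
... | true  = s≤s (count-≤ (p ∘ suc))
... | false = m≤n⇒m≤1+n (count-≤ (p ∘ suc))

count-pos : ∀ {n} {p : Fin n → Bool} i → p i ≡ true → 0 < count p
count-pos         zero    pi rewrite pi = s≤s z≤n
count-pos {p = p} (suc i) pi = ≤-trans (count-pos i pi) (m≤n+m _ (if p zero then 1 else 0))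

count-∧ˡ : ∀ {n} x (p : Fin n → Bool) → count (λ i → x ∧ p i) ≡ (if x then count p else 0)
count-∧ˡ     true  p = refl
count-∧ˡ {n} false p = count-false n

count-++ : ∀ m {n} (p : Fin (m + n) → Bool) → count p ≡ count (p ∘ (_↑ˡ n)) + count (p ∘ (m ↑ʳ_))
count-++ zero    p = refl
count-++ (suc m) p = trans (cong (x +_) (count-++ m (p ∘ suc))) (sym (+-assoc x _ _))
  where x = if p zero then 1 else 0

count-split : ∀ {n} (q p : Fin n → Bool) →
  count p ≡ count (λ i → q i ∧ p i) + count (λ i → not (q i) ∧ p i)
count-split {zero}  q p = refl
count-split {suc n} q p =
  trans (cong (x +_) (count-split (q ∘ suc) (p ∘ suc))) (regroup (q zero))
  where
  x = if p zero then 1 else 0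
  C = count (λ i → q (suc i) ∧ p (suc i))
  D = count (λ i → not (q (suc i)) ∧ p (suc i))
  regroup : ∀ b →
    x + (C + D) ≡ (if b ∧ p zero then 1 else 0) + C + ((if not b ∧ p zero then 1 else 0) + D)
  regroup true  = sym (+-assoc x C D)
  regroup false = x∙yz≈y∙xz +-commutativeSemigroup x C D

count-remove : ∀ {n} (v : Fin n) (p : Fin n → Bool) →
  count (λ w → not ⌊ v ≟ w ⌋ ∧ p w) + (if p v then 1 else 0) ≡ count p
count-remove zero    p = +-comm (count (p ∘ suc)) _
count-remove (suc v) p = begin
  x + count (λ w → not ⌊ suc v ≟ suc w ⌋ ∧ p (suc w)) + y ≡⟨ cong (λ n → x + n + y) (count-cong unshift) ⟩
  x + count (λ w → not ⌊ v ≟ w ⌋ ∧ p (suc w)) + y         ≡⟨ +-assoc x _ y ⟩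
  x + (count (λ w → not ⌊ v ≟ w ⌋ ∧ p (suc w)) + y)       ≡⟨ cong (x +_) (count-remove v (p ∘ suc)) ⟩
  x + count (p ∘ suc)                                     ∎
  where
  open ≡-Reasoning
  x = if p zero then 1 else 0
  y = if p (suc v) then 1 else 0
  unshift : ∀ w → not ⌊ suc v ≟ suc w ⌋ ∧ p (suc w) ≡ not ⌊ v ≟ w ⌋ ∧ p (suc w)
  unshift w = cong (λ b → not b ∧ p (suc w)) (⌊⌋-map′ _ _ (v ≟ w))

⌊⌋-true : ∀ {p} {P : Set p} (d : Dec P) → P → ⌊ d ⌋ ≡ true
⌊⌋-true d x = trans (isYes≗does d) (dec-true d x)

⌊⌋-false : ∀ {p} {P : Set p} (d : Dec P) → ¬ P → ⌊ d ⌋ ≡ false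
⌊⌋-false d ¬x = trans (isYes≗does d) (dec-false d ¬x)

labelCount : ∀ {n} → (Fin n → Bool) → Bool → ℕ
labelCount f t = count (λ i → ⌊ f i Bool.≟ t ⌋)

labelCount-all : ∀ {n} {f : Fin n → Bool} {t} → (∀ i → f i ≡ t) → labelCount f t ≡ n
labelCount-all {n} {f} {t} eq = trans (count-cong (λ i → ⌊⌋-true (f i Bool.≟ t) (eq i))) (count-true n)

labelCount-none : ∀ {n} {f : Fin n → Bool} {t} → (∀ i → f i ≢ t) → labelCount f t ≡ 0
labelCount-none {n} {f} {t} ne = trans (count-cong (λ i → ⌊⌋-false (f i Bool.≟ t) (ne i))) (count-false n)

bool-dichotomy : ∀ {x y : Bool} → x ≢ y → ∀ z → z ≡ x ⊎ z ≡ y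
bool-dichotomy {x} x≢y z with z Bool.≟ x
... | yes z≡x = inj₁ z≡x
... | no  z≢x = inj₂ (trans (¬-not z≢x) (sym (¬-not (≢-sym x≢y))))

<ᵇ-true : ∀ {m n} → m < n → (m <ᵇ n) ≡ true
<ᵇ-true {m} {n} m<n with m <ᵇ n | <⇒<ᵇ m<n
... | true | _ = refl

<ᵇ-false : ∀ {m n} → n ≤ m → (m <ᵇ n) ≡ false
<ᵇ-false {m} {n} n≤m with m <ᵇ n | <ᵇ⇒< m n
... | false | _   = refl
... | true  | m<n = contradiction (m<n _) (≤⇒≯ n≤m)

m+1+n∸1≡m+n : ∀ m n → m + 1 + n ∸ 1 ≡ m + n
m+1+n∸1≡m+n m n = cong (_∸ 1) (trans (+-assoc m 1 n) (+-suc m n))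

-- Twins v ∈ C₁, w ∈ C₂ with p, q neighbours in their own parts, closed neighbourhoods of
-- sizes P, Q in C₁, C₂, and X, Y non-neighbours there: adding the two cohesion inequalities,
-- everything cancels except X + Y.
twins-arith : ∀ {p q P Q} X Y → p + 1 ≡ P → q + 1 ≡ Q →
  Q * (P + X ∸ 1) ≤ p * (Q + Y) → P * (Q + Y ∸ 1) ≤ q * (P + X) → X + Y ≡ 0
twins-arith {p} {q} X Y refl refl v-cohesive w-cohesive = n≤0⇒n≡0 (+-cancelˡ-≤ R (X + Y) 0 (begin
  R + (X + Y)                                            ≡⟨ expand p q X Y ⟩
  (q + 1) * (p + X) + (p + 1) * (q + Y)                  ≡⟨ sym (cong₂ (λ m n → (q + 1) * m + (p + 1) * n)
                                                                 (m+1+n∸1≡m+n p X) (m+1+n∸1≡m+n q Y)) ⟩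
  (q + 1) * (p + 1 + X ∸ 1) + (p + 1) * (q + 1 + Y ∸ 1)  ≤⟨ +-mono-≤ v-cohesive w-cohesive ⟩
  R                                                      ≡⟨ +-identityʳ R ⟨
  R + 0                                                  ∎))
  where
  open ≤-Reasoning
  R = p * (q + 1 + Y) + q * (p + 1 + X)
  expand : ∀ p q X Y → p * (q + 1 + Y) + q * (p + 1 + X) + (X + Y) ≡ (q + 1) * (p + X) + (p + 1) * (q + Y)
  expand = solve-∀

-- Cohesion at a vertex adjacent to all Y vertices of the other part and to X of the
-- X + 1 others of its own part.
dominating-arith : ∀ X Y → Y * (X + 1) ≤ X * Y → Y ≡ 0
dominating-arith X Y le = n≤0⇒n≡0 (+-cancelˡ-≤ (X * Y) Y 0 (begin
  X * Y + Y    ≡⟨ expand X Y ⟩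
  Y * (X + 1)  ≤⟨ le ⟩
  X * Y        ≡⟨ +-identityʳ (X * Y) ⟨
  X * Y + 0    ∎))
  where
  open ≤-Reasoning
  expand : ∀ X Y → X * Y + Y ≡ Y * (X + 1)
  expand = solve-∀

-- Cohesion at a vertex of B: a neighbours among the a + s vertices of the other part,
-- q = b − 1 among the q + 1 others of its own part.
threshold-arith : ∀ a s q → a * (q + 1) ≤ q * (a + s) → a + s ≤ (q + 1) * s
threshold-arith a s q le = begin
  a + s         ≤⟨ +-monoˡ-≤ s (+-cancelˡ-≤ (q * a) a (q * s) (begin
                     q * a + a    ≡⟨ expandˡ a q ⟩
                     a * (q + 1)  ≤⟨ le ⟩
                     q * (a + s)  ≡⟨ *-distribˡ-+ q a s ⟩
                     q * a + q * s ∎)) ⟩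
  q * s + s     ≡⟨ expandʳ q s ⟩
  (q + 1) * s   ∎
  where
  open ≤-Reasoning
  expandˡ : ∀ a q → q * a + a ≡ a * (q + 1)
  expandˡ = solve-∀
  expandʳ : ∀ q s → q * s + s ≡ (q + 1) * s
  expandʳ = solve-∀

kindAdj-kU : ∀ k → kindAdj k kU ≡ false
kindAdj-kU kA = refl
kindAdj-kU kB = refl
kindAdj-kU kS = refl
kindAdj-kU kU = refl

module Layout (a b s : ℕ) where

  V : Set
  V = Fin (a + b + s + 1)

  κ : V → Kind
  κ v = kind a b s (toℕ v)

  vA : Fin a → V
  vA i = ((i ↑ˡ b) ↑ˡ s) ↑ˡ 1

  vB : Fin b → V
  vB i = ((a ↑ʳ i) ↑ˡ s) ↑ˡ 1

  vS : Fin s → V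
  vS i = ((a + b) ↑ʳ i) ↑ˡ 1

  vU : Fin 1 → V
  vU i = (a + b + s) ↑ʳ i

  u : V
  u = vU zero

  count-blocks : (p : V → Bool) →
    count p ≡ count (p ∘ vA) + count (p ∘ vB) + count (p ∘ vS) + count (p ∘ vU)
  count-blocks p = begin
    count p                                                   ≡⟨ count-++ (a + b + s) p ⟩
    count pAB + count (p ∘ vU)                                ≡⟨ cong (_+ count (p ∘ vU)) (count-++ (a + b) pAB) ⟩
    count (pAB ∘ (_↑ˡ s)) + count (p ∘ vS) + count (p ∘ vU)   ≡⟨ cong (λ n → n + count (p ∘ vS) + count (p ∘ vU))
                                                                   (count-++ a (pAB ∘ (_↑ˡ s))) ⟩
    count (p ∘ vA) + count (p ∘ vB) + count (p ∘ vS) + count (p ∘ vU) ∎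
    where
    open ≡-Reasoning
    pAB = p ∘ (_↑ˡ 1)

  kind-A : ∀ {j} → j < a → kind a b s j ≡ kA
  kind-A j<a rewrite <ᵇ-true j<a = refl

  kind-B : ∀ {j} → a ≤ j → j < a + b → kind a b s j ≡ kB
  kind-B a≤j j<a+b rewrite <ᵇ-false a≤j | <ᵇ-true j<a+b = refl

  kind-S : ∀ {j} → a + b ≤ j → j < a + b + s → kind a b s j ≡ kS
  kind-S a+b≤j j<a+b+s
    rewrite <ᵇ-false (≤-trans (m≤m+n a b) a+b≤j) | <ᵇ-false a+b≤j | <ᵇ-true j<a+b+s = refl

  kind-U : ∀ {j} → a + b + s ≤ j → kind a b s j ≡ kU
  kind-U a+b+s≤j
    rewrite <ᵇ-false (≤-trans (≤-trans (m≤m+n a b) (m≤m+n (a + b) s)) a+b+s≤j)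
          | <ᵇ-false (≤-trans (m≤m+n (a + b) s) a+b+s≤j) | <ᵇ-false a+b+s≤j = refl

  κ-vA : ∀ i → κ (vA i) ≡ kA
  κ-vA i rewrite toℕ-↑ˡ ((i ↑ˡ b) ↑ˡ s) 1 | toℕ-↑ˡ (i ↑ˡ b) s | toℕ-↑ˡ i b = kind-A (toℕ<n i)

  κ-vB : ∀ i → κ (vB i) ≡ kB
  κ-vB i rewrite toℕ-↑ˡ ((a ↑ʳ i) ↑ˡ s) 1 | toℕ-↑ˡ (a ↑ʳ i) s | toℕ-↑ʳ a i =
    kind-B (m≤m+n a (toℕ i)) (+-monoʳ-< a (toℕ<n i))

  κ-vS : ∀ i → κ (vS i) ≡ kS
  κ-vS i rewrite toℕ-↑ˡ ((a + b) ↑ʳ i) 1 | toℕ-↑ʳ (a + b) i =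
    kind-S (m≤m+n (a + b) (toℕ i)) (+-monoʳ-< (a + b) (toℕ<n i))

  κ-vU : ∀ i → κ (vU i) ≡ kU
  κ-vU i rewrite toℕ-↑ʳ (a + b + s) i = kind-U (m≤m+n (a + b + s) (toℕ i))

  module Counting (c : V → Bool) where

    size : Bool → ℕ
    size = partSize (G a b s) c

    deg : Bool → V → ℕ
    deg = nbrsIn (G a b s) c

    A B S U : Bool → ℕ
    A = labelCount (c ∘ vA)
    B = labelCount (c ∘ vB)
    S = labelCount (c ∘ vS)
    U = labelCount (c ∘ vU)

    U≡1 : ∀ {t} → c u ≡ t → U t ≡ 1
    U≡1 u∈t = labelCount-all {f = c ∘ vU} λ { zero → u∈t ; (suc ()) }

    U≡0 : ∀ {t} → c u ≢ t → U t ≡ 0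
    U≡0 u∉t = labelCount-none {f = c ∘ vU} λ { zero → u∉t ; (suc ()) }

    -- For a vertex of kind k, Adj k t is its closed neighbourhood in part t when k is
    -- self-adjacent (A, B) and its open neighbourhood otherwise.
    Adj Non : Kind → Bool → ℕ
    Adj k t = count (λ w → kindAdj k (κ w) ∧ ⌊ c w Bool.≟ t ⌋)
    Non k t = count (λ w → not (kindAdj k (κ w)) ∧ ⌊ c w Bool.≟ t ⌋)

    count-by-kind : ∀ (f : Kind → Bool) t →
      count (λ w → f (κ w) ∧ ⌊ c w Bool.≟ t ⌋)
        ≡ (if f kA then A t else 0) + (if f kB then B t else 0)
          + (if f kS then S t else 0) + (if f kU then U t else 0)
    count-by-kind f t = trans (count-blocks _)
      (cong₂ _+_ (cong₂ _+_ (cong₂ _+_ (block vA κ-vA) (block vB κ-vB)) (block vS κ-vS)) (block vU κ-vU))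
      where
      block : ∀ {m} (v : Fin m → V) {k} → (∀ i → κ (v i) ≡ k) →
        count (λ i → f (κ (v i)) ∧ ⌊ c (v i) Bool.≟ t ⌋) ≡ (if f k then labelCount (c ∘ v) t else 0)
      block v {k} κv = trans (count-cong λ i → cong (λ k → f k ∧ ⌊ c (v i) Bool.≟ t ⌋) (κv i))
                             (count-∧ˡ (f k) (λ i → ⌊ c (v i) Bool.≟ t ⌋))

    size-blocks : ∀ t → size t ≡ A t + B t + S t + U t
    size-blocks = count-by-kind (λ _ → true)

    size-split : ∀ k t → size t ≡ Adj k t + Non k t
    size-split k t = count-split (λ w → kindAdj k (κ w)) (λ w → ⌊ c w Bool.≟ t ⌋)

    Adj-A : ∀ t → Adj kA t ≡ A t + B t + S t
    Adj-A t = trans (count-by-kind (kindAdj kA) t) (+-identityʳ _)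

    Adj-B : ∀ t → Adj kB t ≡ A t + B t
    Adj-B t = trans (count-by-kind (kindAdj kB) t) (trans (+-identityʳ _) (+-identityʳ _))

    Adj-S : ∀ t → Adj kS t ≡ A t
    Adj-S t = trans (count-by-kind (kindAdj kS) t)
                    (trans (+-identityʳ _) (trans (+-identityʳ _) (+-identityʳ _)))

    deg-self : ∀ t v → deg t v + (if kindAdj (κ v) (κ v) ∧ ⌊ c v Bool.≟ t ⌋ then 1 else 0) ≡ Adj (κ v) t
    deg-self t v = trans (cong (_+ (if adjacent v ∧ ⌊ c v Bool.≟ t ⌋ then 1 else 0))
                               (count-cong λ w → ∧-assoc (not ⌊ v ≟ w ⌋) (adjacent w) ⌊ c w Bool.≟ t ⌋))
                         (count-remove v (λ w → adjacent w ∧ ⌊ c w Bool.≟ t ⌋))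
      where
      adjacent : V → Bool
      adjacent w = kindAdj (κ v) (κ w)

    deg-own : ∀ {v k t} → κ v ≡ k → kindAdj k k ≡ true → c v ≡ t → deg t v + 1 ≡ Adj k t
    deg-own {v} refl loop refl =
      trans (cong (λ x → deg (c v) v + (if x then 1 else 0)) (sym self-counted)) (deg-self (c v) v)
      where self-counted = cong₂ _∧_ loop (⌊⌋-true (c v Bool.≟ c v) refl)

    deg-other : ∀ {v k t} → κ v ≡ k → c v ≢ t → deg t v ≡ Adj k t
    deg-other {v} {t = t} refl c≢t =
      trans (sym (+-identityʳ _))
            (trans (cong (λ x → deg t v + (if x then 1 else 0)) (sym self-uncounted)) (deg-self t v))
      where
      self-uncounted = trans (cong (kindAdj (κ v) (κ v) ∧_) (⌊⌋-false (c v Bool.≟ t) c≢t)) (∧-zeroʳ _)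

    deg-loopless : ∀ {v k t} → κ v ≡ k → kindAdj k k ≡ false → deg t v ≡ Adj k t
    deg-loopless {v} {t = t} refl loopless =
      trans (sym (+-identityʳ _))
            (trans (cong (λ x → deg t v + (if x ∧ ⌊ c v Bool.≟ t ⌋ then 1 else 0)) (sym loopless))
                   (deg-self t v))

    Non-u-pos : ∀ k → 0 < Non k (c u)
    Non-u-pos k = count-pos u (cong₂ _∧_ (cong not (trans (cong (kindAdj k) (κ-vU zero)) (kindAdj-kU k)))
                                     (⌊⌋-true (c u Bool.≟ c u) refl))

    Non-apart-pos : ∀ k {t o} → t ≢ o → 0 < Non k t + Non k o
    Non-apart-pos k t≢o with bool-dichotomy t≢o (c u)
    ... | inj₁ refl = <-≤-trans (Non-u-pos k) (m≤m+n _ _)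
    ... | inj₂ refl = <-≤-trans (Non-u-pos k) (m≤n+m _ _)

    module Cohesion (H : IsTwoCommunityStructure (G a b s) c) where

      size≥2 : ∀ t → 2 ≤ size t
      size≥2 true  = proj₁ H
      size≥2 false = proj₁ (proj₂ H)

      cohesive : ∀ {v t o} → c v ≡ t → t ≢ o → deg o v * (size t ∸ 1) ≤ deg t v * size o
      cohesive {v} refl t≢o with ¬-not (≢-sym t≢o)
      ... | refl = proj₂ (proj₂ H) v

      cohesive-split : ∀ {v k t o} → κ v ≡ k → c v ≡ t → t ≢ o →
        Adj k o * (Adj k t + Non k t ∸ 1) ≤ deg t v * (Adj k o + Non k o)
      cohesive-split {v} {k} {t} {o} κv cv t≢o = begin
        Adj k o * (Adj k t + Non k t ∸ 1) ≡⟨ cong₂ (λ d n → d * (n ∸ 1))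
                                                    (deg-other κv (λ e → t≢o (trans (sym cv) e))) (size-split k t) ⟨
        deg o v * (size t ∸ 1)            ≤⟨ cohesive cv t≢o ⟩
        deg t v * size o                  ≡⟨ cong (deg t v *_) (size-split k o) ⟩
        deg t v * (Adj k o + Non k o)     ∎
        where open ≤-Reasoning

      twins-same-part : ∀ {v w k} → κ v ≡ k → κ w ≡ k → kindAdj k k ≡ true → c v ≡ c w
      twins-same-part {v} {w} {k} κv κw loop with c v Bool.≟ c w
      ... | yes same   = same
      ... | no  differ = contradiction
        (twins-arith (Non k (c v)) (Non k (c w)) (deg-own κv loop refl) (deg-own κw loop refl)
                     (cohesive-split κv refl differ) (cohesive-split κw refl (≢-sym differ)))
        (>⇒≢ (Non-apart-pos k differ))

      module Placement (a>0 : 0 < a) where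

        a₀ : Fin a
        a₀ = fromℕ< a>0

        t o : Bool
        t = c (vA a₀)
        o = not t

        t≢o : t ≢ o
        t≢o = not-¬ refl

        A-in-t : ∀ i → c (vA i) ≡ t
        A-in-t i = twins-same-part (κ-vA i) (κ-vA a₀) refl

        A[t]≡a : A t ≡ a
        A[t]≡a = labelCount-all A-in-t

        A[o]≡0 : A o ≡ 0
        A[o]≡0 = labelCount-none (λ i → not-¬ (A-in-t i))

        S-in-t : ∀ i → c (vS i) ≡ t
        S-in-t i with c (vS i) Bool.≟ t
        ... | yes w∈t = w∈t
        ... | no  w∉t = contradiction (≤-trans lower-bound upper-bound) λ ()
          where
          w = vS i
          lower-bound : 1 ≤ deg t w * (size o ∸ 1)
          lower-bound = subst (λ d → 1 ≤ d * (size o ∸ 1))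
                              (sym (trans (deg-loopless (κ-vS i) refl) (trans (Adj-S t) A[t]≡a)))
                              (*-mono-≤ a>0 (∸-monoˡ-≤ 1 (size≥2 o)))
          upper-bound : deg t w * (size o ∸ 1) ≤ 0
          upper-bound = subst (λ d → deg t w * (size o ∸ 1) ≤ d * size t)
                              (trans (deg-loopless (κ-vS i) refl) (trans (Adj-S o) A[o]≡0))
                              (cohesive (¬-not w∉t) (≢-sym t≢o))

        S[t]≡s : S t ≡ s
        S[t]≡s = labelCount-all S-in-t

        S[o]≡0 : S o ≡ 0
        S[o]≡0 = labelCount-none (λ i → not-¬ (S-in-t i))

        size[t]≡a+B+s+U : size t ≡ a + B t + s + U t
        size[t]≡a+B+s+U =
          trans (size-blocks t) (cong (λ n → n + U t) (cong₂ (λ x y → x + B t + y) A[t]≡a S[t]≡s))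

        size[o]≡B+U : size o ≡ B o + U o
        size[o]≡B+U = trans (size-blocks o)
          (cong (_+ U o) (trans (cong₂ (λ x y → x + B o + y) A[o]≡0 S[o]≡0) (+-identityʳ (B o))))

        B-in-o : ∀ i → c (vB i) ≡ o
        B-in-o i with c (vB i) Bool.≟ t
        ... | no  v∉t = ¬-not v∉t
        ... | yes v∈t = contradiction (size≥2 o) (≤⇒≯ (begin
          size o      ≡⟨ size[o]≡B+U ⟩
          B o + U o   ≡⟨ cong (_+ U o) B-empty ⟩
          U o         ≤⟨ count-≤ (λ i → ⌊ c (vU i) Bool.≟ o ⌋) ⟩
          1           ∎))
          where
          open ≤-Reasoning
          B-empty : B o ≡ 0
          B-empty = labelCount-none (λ j → not-¬ (trans (twins-same-part (κ-vB j) (κ-vB i) refl) v∈t))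

        B-not-in-t : ∀ i → c (vB i) ≢ t
        B-not-in-t i e = t≢o (trans (sym e) (B-in-o i))

        B[o]≡b : B o ≡ b
        B[o]≡b = labelCount-all B-in-o

        B[t]≡0 : B t ≡ 0
        B[t]≡0 = labelCount-none B-not-in-t

        u-apart-from-A : 0 < b → c u ≢ t
        u-apart-from-A b>0 u∈t = >⇒≢ b>0 (dominating-arith p b (begin
          b * (p + 1)              ≡⟨ cong₂ _*_ deg[o]≡b size[t]∸1≡p+1 ⟨
          deg o v₀ * (size t ∸ 1)  ≤⟨ cohesive refl t≢o ⟩
          p * size o               ≡⟨ cong (p *_) size[o]≡b ⟩
          p * b                    ∎))
          where
          open ≤-Reasoning
          v₀ = vA a₀
          p = deg t v₀
          deg[o]≡b : deg o v₀ ≡ b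
          deg[o]≡b = trans (deg-other (κ-vA a₀) t≢o)
                 (trans (Adj-A o) (trans (cong₂ (λ x y → x + B o + y) A[o]≡0 S[o]≡0)
                                         (trans (+-identityʳ (B o)) B[o]≡b)))
          size[t]∸1≡p+1 : size t ∸ 1 ≡ p + 1
          size[t]∸1≡p+1 = trans (cong (_∸ 1) (trans (size-blocks t) (cong₂ _+_ A+B+S≡p+1 (U≡1 u∈t))))
                                (m+n∸n≡m (p + 1) 1)
            where A+B+S≡p+1 = trans (sym (Adj-A t)) (sym (deg-own (κ-vA a₀) refl refl))
          size[o]≡b : size o ≡ b
          size[o]≡b = trans size[o]≡B+U
            (trans (cong₂ _+_ B[o]≡b (U≡0 (λ u∈o → t≢o (trans (sym u∈t) u∈o)))) (+-identityʳ b))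

        a+s≤b*s : 0 < b → c u ≢ t → a + s ≤ b * s
        a+s≤b*s b>0 u∉t = subst (λ n → a + s ≤ n * s) q+1≡b (threshold-arith a s q (begin
          a * (q + 1)              ≡⟨ cong₂ _*_ deg[t]≡a size[o]∸1≡q+1 ⟨
          deg t v₁ * (size o ∸ 1)  ≤⟨ cohesive (B-in-o b₀) (≢-sym t≢o) ⟩
          q * size t               ≡⟨ cong (q *_) size[t]≡a+s ⟩
          q * (a + s)              ∎))
          where
          open ≤-Reasoning
          b₀ = fromℕ< b>0
          v₁ = vB b₀
          q = deg o v₁
          q+1≡b : q + 1 ≡ b
          q+1≡b = trans (deg-own (κ-vB b₀) refl (B-in-o b₀)) (trans (Adj-B o) (cong₂ _+_ A[o]≡0 B[o]≡b))
          deg[t]≡a : deg t v₁ ≡ a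
          deg[t]≡a = trans (deg-other (κ-vB b₀) (B-not-in-t b₀))
                 (trans (Adj-B t) (trans (cong₂ _+_ A[t]≡a B[t]≡0) (+-identityʳ a)))
          size[o]∸1≡q+1 : size o ∸ 1 ≡ q + 1
          size[o]∸1≡q+1 = trans (cong (_∸ 1) (trans size[o]≡B+U (cong₂ _+_ B[o]≡q+1 (U≡1 (¬-not u∉t)))))
                                (m+n∸n≡m (q + 1) 1)
            where B[o]≡q+1 = trans B[o]≡b (sym q+1≡b)
          size[t]≡a+s : size t ≡ a + s
          size[t]≡a+s = trans size[t]≡a+B+s+U (trans (cong₂ (λ x y → a + x + s + y) B[t]≡0 (U≡0 u∉t))
                                                 (trans (+-identityʳ (a + 0 + s)) (cong (_+ s) (+-identityʳ a))))

theorem5 : (a b s : ℕ) → 0 < a → 0 < b → 0 < s →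
    b * s < a + s →
    (c : Fin (Graph.n (G a b s)) → Bool) → ¬ IsTwoCommunityStructure (G a b s) c
theorem5 a b s a>0 b>0 _ bs<a+s c H = <⇒≱ bs<a+s (a+s≤b*s b>0 (u-apart-from-A b>0))
  where
  open Layout a b s
  open Counting c
  open Cohesion H
  open Placement a>0
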